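{- Let $m,n$ be positive integers with $\gcd(m+1,n+1)=1$. Then the complete tripartite graph $K_{1,m,n}$ has an interval $(m+n)$-coloring.
   Context: All graphs are finite, undirected, without loops or multiple edges. $K_{1,m,n}$ denotes the complete tripartite graph with parts of sizes $1$, $m$ and $n$ (equivalently, the complete bipartite graph $K_{m,n}$ together with one extra vertex adjacent to all of its vertices). A proper edge-coloring of a graph $G$ with colors $1,\ldots,t$ is an interval $t$-coloring if all $t$ colors are used and, for every vertex $v$ of $G$, the set of colors of the edges incident to $v$ (which are pairwise distinct) forms an interval of consecutive integers. -}

module Defs where

open import Data.Nat using (ℕ; _≤_)
open import Data.Fin using (Fin)
open import Data.Unit using (⊤)
open import Data.Empty using (⊥)
open import Data.Sum using (_⊎_; inj₁; inj₂)
open import Data.Product using (Σ; ∃; _×_; _,_)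
open import Relation.Binary.PropositionalEquality using (_≡_)
open import Relation.Nullary using (¬_)
open import Level using (Level; suc; _⊔_)

record Graph : Set₁ where
  field
    V     : Set
    Adj   : V → V → Set
    irrefl : ∀ {u} → ¬ Adj u u
    sym   : ∀ {u v} → Adj u v → Adj v u
open Graph public

-- An edge-coloring with colours in ℕ: colour assigned to each (unordered) edge,
-- given as a function on adjacent ordered pairs that is symmetric and
-- independent of the adjacency proof.
record IntervalColoring (G : Graph) (t : ℕ) : Set where
  field
    col       : ∀ u v → Adj G u v → ℕ
    col-sym   : ∀ u v (p : Adj G u v) (q : Adj G v u) → col u v p ≡ col v u q
    col-range : ∀ u v (p : Adj G u v) → 1 ≤ col u v p × col u v p ≤ t
    proper    : ∀ u v w (p : Adj G u v) (q : Adj G u w) →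
                col u v p ≡ col u w q → v ≡ w
    surj      : ∀ k → 1 ≤ k → k ≤ t → Σ (V G) λ u → Σ (V G) λ v →
                Σ (Adj G u v) λ p → col u v p ≡ k
    interval  : ∀ u v w (p : Adj G u v) (q : Adj G u w) k →
                col u v p ≤ k → k ≤ col u w q →
                Σ (V G) λ x → Σ (Adj G u x) λ r → col u x r ≡ k

TriV : ℕ → ℕ → Set
TriV m n = ⊤ ⊎ (Fin m ⊎ Fin n)

TriAdj : ∀ {m n} → TriV m n → TriV m n → Set
TriAdj (inj₁ _) (inj₁ _) = ⊥
TriAdj (inj₁ _) (inj₂ _) = ⊤
TriAdj (inj₂ _) (inj₁ _) = ⊤
TriAdj (inj₂ (inj₁ _)) (inj₂ (inj₁ _)) = ⊥
TriAdj (inj₂ (inj₁ _)) (inj₂ (inj₂ _)) = ⊤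
TriAdj (inj₂ (inj₂ _)) (inj₂ (inj₁ _)) = ⊤
TriAdj (inj₂ (inj₂ _)) (inj₂ (inj₂ _)) = ⊥

TriAdj-irrefl : ∀ {m n} {u : TriV m n} → ¬ TriAdj u u
TriAdj-irrefl {u = inj₁ _} ()
TriAdj-irrefl {u = inj₂ (inj₁ _)} ()
TriAdj-irrefl {u = inj₂ (inj₂ _)} ()

TriAdj-sym : ∀ {m n} {u v : TriV m n} → TriAdj u v → TriAdj v u
TriAdj-sym {u = inj₁ _} {inj₂ _} p = _
TriAdj-sym {u = inj₂ _} {inj₁ _} p = _
TriAdj-sym {u = inj₂ (inj₁ _)} {inj₂ (inj₂ _)} p = _
TriAdj-sym {u = inj₂ (inj₂ _)} {inj₂ (inj₁ _)} p = _

K1 : ℕ → ℕ → Graph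
K1 m n = record { V = TriV m n ; Adj = TriAdj ; irrefl = TriAdj-irrefl ; sym = TriAdj-sym }

-- Give the edge a_i b_j the colour i + j + 1 (0-based indices) and the edge
-- from the centre to a_i either i or i + n + 1, to b_j either j or j + m + 1:
-- every leaf then sees an interval, and it remains to choose so that the m + n
-- centre colours are exactly {1, …, m + n}.  Such choices are built along
-- Euclid's algorithm on (m + 1, n + 1).  A choice for (m, n) extends to one for
-- (m, n + m + 1): the new vertex b_n takes the colour m + n + 1, and a_i keeps
-- its colour i, leaving the fresh colour m + n + 2 + i to b_{n+1+i}, or else
-- takes that fresh colour and passes its old colour i + n + 1 to b_{n+1+i}.
-- Coprimality makes the algorithm end at (0, 0).

module Submission where

open import Defs
open import Data.Nat using (ℕ; suc; _+_; _≤_)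
open import Data.Nat.GCD using (gcd)
open import Relation.Binary.PropositionalEquality using (_≡_)

open import Data.Bool using (Bool; true; false; not; if_then_else_)
open import Data.Empty using (⊥; ⊥-elim)
open import Data.Fin using (Fin; zero; suc; toℕ; fromℕ<; splitAt)
open import Data.Fin.Properties
  using (toℕ-injective; toℕ<n; toℕ-fromℕ<; toℕ-↑ˡ; toℕ-↑ʳ; splitAt⁻¹-↑ˡ; splitAt⁻¹-↑ʳ;
         +↔⊎)
open import Data.Nat using (zero; _<_; z≤n; s≤s; _≤?_)
open import Data.Nat.Coprimality using (Coprime; gcd≡1⇒coprime)
import Data.Nat.Coprimality as Coprime
open import Data.Nat.Divisibility using (∣-refl; ∣m∣n⇒∣m+n)
open import Data.Nat.Properties
open import Data.Nat.Tactic.RingSolver using (solve-∀)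
open import Data.Product using (Σ; ∃; _×_; _,_; proj₁; proj₂)
open import Data.Sum using (_⊎_; inj₁; inj₂; [_,_]′)
import Data.Sum as Sum
open import Data.Sum.Algebra using (⊎-comm; ⊎-assoc; ⊎-cong)
open import Function using (_∘_; _↔_; Inverse; mk↔ₛ′)
open import Function.Definitions using (Injective)
open import Function.Properties.Inverse using (↔-refl; ↔-sym; ↔-trans)
open import Level using (0ℓ)
open import Relation.Binary.Definitions using (tri<; tri≈; tri>)
open import Relation.Binary.PropositionalEquality
  using (refl; trans; cong; subst; _≢_; ≢-sym; module ≡-Reasoning)
import Relation.Binary.PropositionalEquality as ≡
open import Relation.Nullary using (yes; no)

addIf : Bool → ℕ → ℕ → ℕ
addIf true  d x = x + d
addIf false d x = x

record Enumerates {A : Set} (f : A → ℕ) (t : ℕ) : Set where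
  field
    injective : Injective _≡_ _≡_ f
    bounded   : ∀ x → 1 ≤ f x × f x ≤ t
    onto      : ∀ k → 1 ≤ k → k ≤ t → ∃ λ x → f x ≡ k

suc∘toℕ-enumerates : ∀ t → Enumerates (suc ∘ toℕ {t}) t
suc∘toℕ-enumerates t = record
  { injective = toℕ-injective ∘ suc-injective
  ; bounded   = λ i → s≤s z≤n , toℕ<n i
  ; onto      = λ { (suc k) _ k<t → fromℕ< k<t , cong suc (toℕ-fromℕ< k<t) }
  }

enumerates-++ : ∀ {A B : Set} {f : A → ℕ} {g : B → ℕ} {s t} →
                Enumerates f s → Enumerates g t → Enumerates [ f , (s +_) ∘ g ]′ (s + t)
enumerates-++ {f = f} {g} {s} {t} F G = record
  { injective = injective ; bounded = bounded ; onto = onto }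
  where
  module F = Enumerates F
  module G = Enumerates G

  left<right : ∀ x y → f x < s + g y
  left<right x y = ≤-<-trans (proj₂ (F.bounded x)) (m<m+n s (proj₁ (G.bounded y)))

  injective : Injective _≡_ _≡_ [ f , (s +_) ∘ g ]′
  injective {inj₁ x} {inj₁ y} e = cong inj₁ (F.injective e)
  injective {inj₁ x} {inj₂ y} e = ⊥-elim (<⇒≢ (left<right x y) e)
  injective {inj₂ x} {inj₁ y} e = ⊥-elim (<⇒≢ (left<right y x) (≡.sym e))
  injective {inj₂ x} {inj₂ y} e = cong inj₂ (G.injective (+-cancelˡ-≡ s _ _ e))

  bounded : ∀ x → 1 ≤ [ f , (s +_) ∘ g ]′ x × [ f , (s +_) ∘ g ]′ x ≤ s + t
  bounded (inj₁ x) = proj₁ (F.bounded x) , ≤-trans (proj₂ (F.bounded x)) (m≤m+n s t)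
  bounded (inj₂ y) = ≤-trans (proj₁ (G.bounded y)) (m≤n+m _ s) , +-monoʳ-≤ s (proj₂ (G.bounded y))

  onto : ∀ k → 1 ≤ k → k ≤ s + t → ∃ λ x → [ f , (s +_) ∘ g ]′ x ≡ k
  onto k 1≤k k≤s+t with k ≤? s
  ... | yes k≤s = let x , e = F.onto k 1≤k k≤s in inj₁ x , e
  ... | no k≰s with m≤n⇒∃[o]m+o≡n (<⇒≤ (≰⇒> k≰s))
  ...   | o , refl = let y , e = G.onto o 1≤o (+-cancelˡ-≤ s o t k≤s+t) in inj₂ y , cong (s +_) e
    where
    1≤o : 1 ≤ o
    1≤o = +-cancelˡ-< s 0 o (subst (_< s + o) (≡.sym (+-identityʳ s)) (≰⇒> k≰s))

enumerates-↔ : ∀ {A B : Set} {f : B → ℕ} {g : A → ℕ} {t} (σ : A ↔ B) →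
               (∀ x → g x ≡ f (Inverse.to σ x)) → Enumerates f t → Enumerates g t
enumerates-↔ {f = f} {g} {t} σ g≡f∘σ F = record
  { injective = injective
  ; bounded   = λ x → subst (λ c → 1 ≤ c × c ≤ t) (≡.sym (g≡f∘σ x)) (F.bounded (to x))
  ; onto      = onto
  }
  where
  open Inverse σ
  module F = Enumerates F
  open ≡-Reasoning

  injective : Injective _≡_ _≡_ g
  injective {x} {y} e = begin
    x             ≡⟨ strictlyInverseʳ x ⟨
    from (to x)   ≡⟨ cong from (F.injective (trans (≡.sym (g≡f∘σ x)) (trans e (g≡f∘σ y)))) ⟩
    from (to y)   ≡⟨ strictlyInverseʳ y ⟩
    y             ∎

  onto : ∀ k → 1 ≤ k → k ≤ t → ∃ λ x → g x ≡ k
  onto k 1≤k k≤t = let y , e = F.onto k 1≤k k≤t in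
    from y , trans (g≡f∘σ (from y)) (trans (cong f (strictlyInverseˡ y)) e)

centreColour : ∀ {m n} → (Fin m ⊎ Fin n → Bool) → Fin m ⊎ Fin n → ℕ
centreColour {m} {n} raised (inj₁ i) = addIf (raised (inj₁ i)) (suc n) (toℕ i)
centreColour {m} {n} raised (inj₂ j) = addIf (raised (inj₂ j)) (suc m) (toℕ j)

record CentreColouring (m n : ℕ) : Set where
  field
    raised            : Fin m ⊎ Fin n → Bool
    colour-enumerates : Enumerates (centreColour raised) (m + n)

emptyCentreColouring : CentreColouring 0 0
emptyCentreColouring = record
  { raised            = ⊥-elim ∘ noIndex
  ; colour-enumerates = record
    { injective = λ {x} → ⊥-elim (noIndex x)
    ; bounded   = ⊥-elim ∘ noIndex
    ; onto      = λ { _ (s≤s _) () }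
    }
  }
  where
  noIndex : Fin 0 ⊎ Fin 0 → ⊥
  noIndex (inj₁ ())
  noIndex (inj₂ ())

swapParts : ∀ {m n} → CentreColouring m n → CentreColouring n m
swapParts {m} {n} C = record
  { raised            = raised ∘ Sum.swap
  ; colour-enumerates = subst (Enumerates _) (+-comm m n)
      (enumerates-↔ (⊎-comm _ _) colour-swap colour-enumerates)
  }
  where
  open CentreColouring C
  colour-swap : ∀ x → centreColour (raised ∘ Sum.swap) x ≡ centreColour raised (Sum.swap x)
  colour-swap (inj₁ _) = refl
  colour-swap (inj₂ _) = refl

toℕ-splitAt-inj₁ : ∀ {m n} {j : Fin (m + n)} {i} → splitAt m j ≡ inj₁ i → toℕ j ≡ toℕ i
toℕ-splitAt-inj₁ {n = n} {i = i} eq = trans (cong toℕ (≡.sym (splitAt⁻¹-↑ˡ eq))) (toℕ-↑ˡ i n)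

toℕ-splitAt-inj₂ : ∀ {m n} {j : Fin (m + n)} {i} → splitAt m j ≡ inj₂ i → toℕ j ≡ m + toℕ i
toℕ-splitAt-inj₂ {m} {i = i} eq = trans (cong toℕ (≡.sym (splitAt⁻¹-↑ʳ eq))) (toℕ-↑ʳ m i)

-- Code indexes the old colours {1, …, m + n} (through C) together with the new
-- colours m + n + 1 + k; regroup sends each vertex of the extended parts to the
-- colour it receives, b_n getting k = 0 and the pair a_i, b_{n+1+i} sharing k = 1 + i.
module Extension {m n : ℕ} (C : CentreColouring m n) where
  open CentreColouring C

  Code : Set
  Code = (Fin m ⊎ Fin n) ⊎ Fin (suc m)

  codeColour : Code → ℕ
  codeColour = [ centreColour raised , (m + n +_) ∘ suc ∘ toℕ ]′

  exchange : Code → Code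
  exchange (inj₁ (inj₁ i)) = if raised (inj₁ i) then inj₂ (suc i) else inj₁ (inj₁ i)
  exchange (inj₂ (suc i))  = if raised (inj₁ i) then inj₁ (inj₁ i) else inj₂ (suc i)
  exchange x               = x

  exchange-involutive : ∀ x → exchange (exchange x) ≡ x
  exchange-involutive (inj₁ (inj₁ i)) with raised (inj₁ i) in r
  ... | true  rewrite r = refl
  ... | false rewrite r = refl
  exchange-involutive (inj₂ (suc i)) with raised (inj₁ i) in r
  ... | true  rewrite r = refl
  ... | false rewrite r = refl
  exchange-involutive (inj₁ (inj₂ _)) = refl
  exchange-involutive (inj₂ zero)     = refl

  regroup : (Fin m ⊎ Fin (n + suc m)) ↔ Code
  regroup = ↔-trans (⊎-cong ↔-refl (+↔⊎ {n})) (↔-trans (↔-sym (⊎-assoc 0ℓ _ _ _)) exchange↔)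
    where
    exchange↔ : Code ↔ Code
    exchange↔ = mk↔ₛ′ exchange exchange exchange-involutive exchange-involutive

  raisedTail : Fin (suc m) → Bool
  raisedTail zero    = true
  raisedTail (suc i) = not (raised (inj₁ i))

  raised′ : Fin m ⊎ Fin (n + suc m) → Bool
  raised′ (inj₁ i) = raised (inj₁ i)
  raised′ (inj₂ j) = [ raised ∘ inj₂ , raisedTail ]′ (splitAt n j)

  private
    raised-a : ∀ i n m → i + suc (n + suc m) ≡ m + n + suc (suc i)
    raised-a = solve-∀
    middle : ∀ n m → n + 0 + suc m ≡ m + n + 1
    middle = solve-∀
    lowered-b : ∀ i n → n + suc i ≡ i + suc n
    lowered-b = solve-∀
    raised-b : ∀ i n m → n + suc i + suc m ≡ m + n + suc (suc i)
    raised-b = solve-∀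

  colour-regroup : ∀ x → centreColour raised′ x ≡ codeColour (Inverse.to regroup x)
  colour-regroup (inj₁ i) with raised (inj₁ i) in r
  ... | true  = raised-a (toℕ i) n m
  ... | false rewrite r = refl
  colour-regroup (inj₂ j) with splitAt n j in eq
  ... | inj₁ j′ = cong (addIf (raised (inj₂ j′)) (suc m)) (toℕ-splitAt-inj₁ eq)
  ... | inj₂ zero = trans (cong (_+ suc m) (toℕ-splitAt-inj₂ eq)) (middle n m)
  ... | inj₂ (suc i) with raised (inj₁ i) in r
  ...   | true rewrite r = trans (toℕ-splitAt-inj₂ eq) (lowered-b (toℕ i) n)
  ...   | false = trans (cong (_+ suc m) (toℕ-splitAt-inj₂ eq)) (raised-b (toℕ i) n m)

  extended : CentreColouring m (n + suc m)
  extended = record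
    { raised            = raised′
    ; colour-enumerates = subst (Enumerates _) (+-assoc m n (suc m))
        (enumerates-↔ regroup colour-regroup
          (enumerates-++ colour-enumerates (suc∘toℕ-enumerates (suc m))))
    }

coprime-+⁻ : ∀ {a b} → Coprime a (b + a) → Coprime a b
coprime-+⁻ c (d∣a , d∣b) = c (d∣a , ∣m∣n⇒∣m+n d∣b d∣a)

centreColouring   : ∀ s m n → m + n < s → Coprime (suc m) (suc n) → CentreColouring m n
centreColouring-< : ∀ s m n → m < n → m + n ≤ s → Coprime (suc m) (suc n) → CentreColouring m n

centreColouring zero    m n () _
centreColouring (suc s) m n m+n<s c with <-cmp m n
... | tri< m<n _ _ = centreColouring-< s m n m<n (≤-pred m+n<s) c
... | tri> _ _ n<m =
  swapParts (centreColouring-< s n m n<m (subst (_≤ s) (+-comm m n) (≤-pred m+n<s))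
                                        (Coprime.sym c))
... | tri≈ _ refl _ with c (∣-refl , ∣-refl)  -- suc m is coprime to itself only if m = 0
...   | refl = emptyCentreColouring

centreColouring-< s m n m<n m+n≤s c with m≤n⇒∃[o]m+o≡n m<n
... | o , refl = subst (CentreColouring m) (+-comm o (suc m)) (Extension.extended smaller)
  where
  smaller : CentreColouring m o
  smaller = centreColouring s m o
    (<-≤-trans (+-monoʳ-< m (s≤s (m≤n+m o m))) m+n≤s)
    (coprime-+⁻ (subst (Coprime (suc m) ∘ suc) (+-comm (suc m) o) c))

-- A vertex with index i in one part, the other part having d vertices and
-- the bit r choosing its centre colour: its colours fill [leafLow r i, leafLow r i + d].
leafLow : Bool → ℕ → ℕ
leafLow false i = i
leafLow true  i = suc i

block-bound : ∀ i {d j} → j < d → suc (i + j) ≤ i + d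
block-bound i {d} {j} j<d = subst (_≤ i + d) (+-suc i j) (+-monoʳ-≤ i j<d)

leaf-centre-within : ∀ r i d → leafLow r i ≤ addIf r (suc d) i × addIf r (suc d) i ≤ leafLow r i + d
leaf-centre-within false i d = ≤-refl , m≤m+n i d
leaf-centre-within true  i d =
  subst (suc i ≤_) (≡.sym (+-suc i d)) (s≤s (m≤m+n i d)) , ≤-reflexive (+-suc i d)

leaf-block-within : ∀ r i {d j} → j < d → leafLow r i ≤ suc (i + j) × suc (i + j) ≤ leafLow r i + d
leaf-block-within r i {d} {j} j<d =
  ≤-trans (leafLow≤suc r) (s≤s (m≤m+n i j)) , ≤-trans (block-bound i j<d) (+-monoˡ-≤ d (≤leafLow r))
  where
  leafLow≤suc : ∀ r → leafLow r i ≤ suc i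
  leafLow≤suc false = n≤1+n i
  leafLow≤suc true  = ≤-refl
  ≤leafLow : ∀ r → i ≤ leafLow r i
  ≤leafLow false = ≤-refl
  ≤leafLow true  = n≤1+n i

leaf-centre-fresh : ∀ r i {d j} → j < d → addIf r (suc d) i ≢ suc (i + j)
leaf-centre-fresh false i {j = j} _    = <⇒≢ (s≤s (m≤m+n i j))
leaf-centre-fresh true  i {d} {j} j<d =
  ≢-sym (<⇒≢ (subst (suc (i + j) <_) (≡.sym (+-suc i d)) (s≤s (block-bound i j<d))))

in-block : ∀ i d k → suc i ≤ k → k ≤ i + d → ∃ λ j → j < d × suc (i + j) ≡ k
in-block i d k i<k k≤i+d with m≤n⇒∃[o]m+o≡n i<k
... | j , refl = j , +-cancelˡ-≤ i (suc j) d (subst (_≤ i + d) (≡.sym (+-suc i j)) k≤i+d) , refl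

leaf-covered : ∀ r i d k → leafLow r i ≤ k → k ≤ leafLow r i + d →
               k ≡ addIf r (suc d) i ⊎ ∃ λ j → j < d × suc (i + j) ≡ k
leaf-covered false i d k i≤k k≤i+d with m≤n⇒m<n∨m≡n i≤k
... | inj₁ i<k  = inj₂ (in-block i d k i<k k≤i+d)
... | inj₂ refl = inj₁ refl
leaf-covered true i d k i<k k≤1+i+d with m≤n⇒m<n∨m≡n k≤1+i+d
... | inj₁ k<1+i+d = inj₂ (in-block i d k i<k (≤-pred k<1+i+d))
... | inj₂ refl    = inj₁ (≡.sym (+-suc i d))

module Colouring {m n : ℕ} (C : CentreColouring m n) where
  open CentreColouring C
  open Enumerates colour-enumerates

  col : (u v : TriV m n) → TriAdj u v → ℕ
  col (inj₁ _)        (inj₂ x)        _ = centreColour raised x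
  col (inj₂ x)        (inj₁ _)        _ = centreColour raised x
  col (inj₂ (inj₁ i)) (inj₂ (inj₂ j)) _ = suc (toℕ i + toℕ j)
  col (inj₂ (inj₂ j)) (inj₂ (inj₁ i)) _ = suc (toℕ j + toℕ i)

  col-sym : ∀ u v (p : TriAdj u v) (q : TriAdj v u) → col u v p ≡ col v u q
  col-sym (inj₁ _)        (inj₂ _)        _ _ = refl
  col-sym (inj₂ _)        (inj₁ _)        _ _ = refl
  col-sym (inj₂ (inj₁ i)) (inj₂ (inj₂ j)) _ _ = cong suc (+-comm (toℕ i) (toℕ j))
  col-sym (inj₂ (inj₂ j)) (inj₂ (inj₁ i)) _ _ = cong suc (+-comm (toℕ j) (toℕ i))

  col-range : ∀ u v (p : TriAdj u v) → 1 ≤ col u v p × col u v p ≤ m + n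
  col-range (inj₁ _)        (inj₂ x)        _ = bounded x
  col-range (inj₂ x)        (inj₁ _)        _ = bounded x
  col-range (inj₂ (inj₁ i)) (inj₂ (inj₂ j)) _ = s≤s z≤n , +-mono-≤ (toℕ<n i) (<⇒≤ (toℕ<n j))
  col-range (inj₂ (inj₂ j)) (inj₂ (inj₁ i)) _ =
    s≤s z≤n ,
    subst (_≤ m + n) (cong suc (+-comm (toℕ i) (toℕ j))) (+-mono-≤ (toℕ<n i) (<⇒≤ (toℕ<n j)))

  proper : ∀ u v w (p : TriAdj u v) (q : TriAdj u w) → col u v p ≡ col u w q → v ≡ w
  proper (inj₁ _) (inj₂ x) (inj₂ y) _ _ e = cong inj₂ (injective e)
  proper (inj₂ _) (inj₁ _) (inj₁ _) _ _ _ = refl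
  proper (inj₂ (inj₁ i)) (inj₁ _) (inj₂ (inj₂ j)) _ _ e =
    ⊥-elim (leaf-centre-fresh (raised (inj₁ i)) (toℕ i) (toℕ<n j) e)
  proper (inj₂ (inj₁ i)) (inj₂ (inj₂ j)) (inj₁ _) _ _ e =
    ⊥-elim (leaf-centre-fresh (raised (inj₁ i)) (toℕ i) (toℕ<n j) (≡.sym e))
  proper (inj₂ (inj₁ i)) (inj₂ (inj₂ j)) (inj₂ (inj₂ j′)) _ _ e =
    cong (inj₂ ∘ inj₂) (toℕ-injective (+-cancelˡ-≡ (toℕ i) _ _ (suc-injective e)))
  proper (inj₂ (inj₂ j)) (inj₁ _) (inj₂ (inj₁ i)) _ _ e =
    ⊥-elim (leaf-centre-fresh (raised (inj₂ j)) (toℕ j) (toℕ<n i) e)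
  proper (inj₂ (inj₂ j)) (inj₂ (inj₁ i)) (inj₁ _) _ _ e =
    ⊥-elim (leaf-centre-fresh (raised (inj₂ j)) (toℕ j) (toℕ<n i) (≡.sym e))
  proper (inj₂ (inj₂ j)) (inj₂ (inj₁ i)) (inj₂ (inj₁ i′)) _ _ e =
    cong (inj₂ ∘ inj₁) (toℕ-injective (+-cancelˡ-≡ (toℕ j) _ _ (suc-injective e)))

  Attains : TriV m n → ℕ → Set
  Attains u k = Σ (TriV m n) λ v → Σ (TriAdj u v) λ p → col u v p ≡ k

  record Span (u : TriV m n) : Set where
    field
      low high : ℕ
      within   : ∀ v (p : TriAdj u v) → low ≤ col u v p × col u v p ≤ high
      covered  : ∀ k → low ≤ k → k ≤ high → Attains u k

  span : ∀ u → Span u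
  span (inj₁ _) = record
    { low = 1 ; high = m + n
    ; within  = λ { (inj₂ x) _ → bounded x }
    ; covered = λ k 1≤k k≤m+n → let x , e = onto k 1≤k k≤m+n in inj₂ x , _ , e
    }
  span (inj₂ (inj₁ i)) = record
    { low = leafLow r (toℕ i) ; high = leafLow r (toℕ i) + n
    ; within  = λ { (inj₁ _) _ → leaf-centre-within r (toℕ i) n
                  ; (inj₂ (inj₂ j)) _ → leaf-block-within r (toℕ i) (toℕ<n j) }
    ; covered = λ k lo≤k k≤hi →
        [ (λ e → inj₁ _ , _ , ≡.sym e) , neighbour ]′ (leaf-covered r (toℕ i) n k lo≤k k≤hi)
    }
    where
    r : Bool
    r = raised (inj₁ i)
    neighbour : ∀ {k} → (∃ λ j → j < n × suc (toℕ i + j) ≡ k) → Attains (inj₂ (inj₁ i)) k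
    neighbour (j , j<n , e) =
      inj₂ (inj₂ (fromℕ< j<n)) , _ , trans (cong (λ x → suc (toℕ i + x)) (toℕ-fromℕ< j<n)) e
  span (inj₂ (inj₂ j)) = record
    { low = leafLow r (toℕ j) ; high = leafLow r (toℕ j) + m
    ; within  = λ { (inj₁ _) _ → leaf-centre-within r (toℕ j) m
                  ; (inj₂ (inj₁ i)) _ → leaf-block-within r (toℕ j) (toℕ<n i) }
    ; covered = λ k lo≤k k≤hi →
        [ (λ e → inj₁ _ , _ , ≡.sym e) , neighbour ]′ (leaf-covered r (toℕ j) m k lo≤k k≤hi)
    }
    where
    r : Bool
    r = raised (inj₂ j)
    neighbour : ∀ {k} → (∃ λ i → i < m × suc (toℕ j + i) ≡ k) → Attains (inj₂ (inj₂ j)) k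
    neighbour (i , i<m , e) =
      inj₂ (inj₁ (fromℕ< i<m)) , _ , trans (cong (λ x → suc (toℕ j + x)) (toℕ-fromℕ< i<m)) e

  intervalColouring : IntervalColoring (K1 m n) (m + n)
  intervalColouring = record
    { col       = col
    ; col-sym   = col-sym
    ; col-range = col-range
    ; proper    = proper
    ; surj      = λ k 1≤k k≤m+n → inj₁ _ , Span.covered (span (inj₁ _)) k 1≤k k≤m+n
    ; interval  = λ u v w p q k v≤k k≤w → let open Span (span u) in
        covered k (≤-trans (proj₁ (within v p)) v≤k) (≤-trans k≤w (proj₂ (within w q)))
    }

mainTheorem1 : ∀ (m n : ℕ) → 1 ≤ m → 1 ≤ n → gcd (suc m) (suc n) ≡ 1 →
    IntervalColoring (K1 m n) (m + n)
mainTheorem1 m n _ _ gcd≡1 =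
  Colouring.intervalColouring (centreColouring (suc (m + n)) m n ≤-refl (gcd≡1⇒coprime gcd≡1))
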